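{- Let $n,k$ be integers with $0<k<n$ and $n-2k+2\ge 0$. Then there exists a $k$-splitting of $Q_2^n$ which contains at most two $(n-k)$-faces of any fixed direction.
   Context: $Q_2^n=\{0,1\}^n$. An $m$-face of $Q_2^n$ is a tuple $a\in\{0,1,*\}^n$ with exactly $m$ entries $*$, identified with the set $\{x\in Q_2^n: x_i=a_i \text{ whenever } a_i\in\{0,1\}\}$; its direction is the set of positions of $*$. A $k$-splitting of $Q_2^n$ is a collection of pairwise disjoint $(n-k)$-faces whose union is $Q_2^n$. -}

module Defs where

open import Data.Nat using (ℕ; zero; suc; _+_; _∸_; _≤_)
open import Data.Bool using (Bool; true; false)
open import Data.Vec using (Vec; []; _∷_; lookup; map)
open import Data.Fin using (Fin)
open import Data.List using (List; length; filter)
import Data.List as List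
open import Data.Product using (Σ; _×_; ∃)
open import Relation.Binary.PropositionalEquality using (_≡_; _≢_)
open import Relation.Nullary using (¬_)
import Data.Vec.Properties as VecP
import Data.Bool.Properties as BoolP

data Sym : Set where
  𝟘 𝟙 ⋆ : Sym

Point : ℕ → Set
Point n = Vec Bool n

Face : ℕ → Set
Face n = Vec Sym n

data _∈ₛ_ : Bool → Sym → Set where
  f∈𝟘 : false ∈ₛ 𝟘
  t∈𝟙 : true ∈ₛ 𝟙
  b∈⋆ : ∀ {b} → b ∈ₛ ⋆

data _∈F_ : {n : ℕ} → Point n → Face n → Set where
  []  : [] ∈F []
  _∷_ : ∀ {n b s} {x : Point n} {a : Face n} → b ∈ₛ s → x ∈F a → (b ∷ x) ∈F (s ∷ a)

isStar : Sym → Bool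
isStar ⋆ = true
isStar _ = false

dim : {n : ℕ} → Face n → ℕ
dim [] = 0
dim (s ∷ a) with isStar s
... | true  = suc (dim a)
... | false = dim a

direction : {n : ℕ} → Face n → Vec Bool n
direction = map isStar

record IsSplitting (n k : ℕ) (F : List (Face n)) : Set where
  field
    faceDim  : ∀ i → dim (List.lookup F i) ≡ n ∸ k
    disjoint : ∀ (i j : Fin (length F)) → i ≢ j →
               ∀ (x : Point n) → ¬ (x ∈F List.lookup F i × x ∈F List.lookup F j)
    cover    : ∀ (x : Point n) → ∃ λ (i : Fin (length F)) → x ∈F List.lookup F i

countDir : {n : ℕ} → Vec Bool n → List (Face n) → ℕ
countDir d F = length (filter (λ a → VecP.≡-dec BoolP._≟_ (direction a) d) F)

-- Induct on the face dimension d = n - k, carrying a triple (F ; G , H) of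
-- partitions of Q₂ⁿ: F into d-faces using every direction at most twice, and
-- G, H into (d+1)-faces using every direction at most twice in total.  Writing
-- prefixes for the first two coordinates, Q₂ⁿ⁺² then carries the triple
--   F′ = 0⋆F ∪ 10G ∪ 11H,   G′ = ⋆⋆F,   H′ = ⋆0G ∪ ⋆1H.
-- A direction of F′ is (0,1,u) with u one of F, or (0,0,u) with u one of G or H;
-- in G′ ∪ H′ it is (1,1,u) resp. (1,0,u) likewise, so both budgets carry over.
-- Together with the product with an edge, (⋆F ; ⋆G , ⋆H), this reaches every
-- admissible (n , k) from a triple for Q₂¹ and one for Q₂⁴ with d = 1.
module Submission where

open import Defs
open import Data.Nat using (ℕ; zero; suc; _+_; _*_; _∸_; _<_; _≤_; _≟_; _≤?_; z≤n; s≤s)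
open import Data.Nat.Properties
  using (+-identityʳ; +-assoc; +-suc; +-cancelˡ-≤; ≤-pred; ≤-refl; 1+n≰n; m≤n⇒m≤1+n;
         m≤n⇒∃[o]m+o≡n; m+n∸m≡n; module ≤-Reasoning)
open import Data.Vec using (Vec; []; _∷_)
import Data.Vec.Properties as VecP
open import Data.Bool using (Bool; true; false)
open import Data.List using (List; []; _∷_; _++_; length; filter; map; lookup)
open import Data.List.Properties using (length-++; map-++; filter-++; filter-accept; filter-some; filter-none)
open import Data.List.Relation.Unary.All using (All; []; _∷_; all?; universal)
import Data.List.Relation.Unary.All as All
open import Data.List.Relation.Unary.All.Properties using (map⁺; ++⁺)
open import Data.List.Relation.Unary.Any using (Any; here; there; index)
open import Data.List.Relation.Unary.Any.Properties using (lookup-index)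
open import Data.List.Membership.Propositional using (lose)
open import Data.List.Membership.Propositional.Properties using (∈-lookup)
open import Data.Fin using (Fin; zero; suc)
open import Data.Product using (Σ; _×_; _,_; ∃; uncurry)
open import Function using (_∘_; _$_)
open import Level using (Level)
open import Relation.Binary.PropositionalEquality
  using (_≡_; _≢_; refl; sym; trans; cong; cong₂; subst; module ≡-Reasoning)
open import Relation.Nullary using (¬_; Dec; yes; no; contradiction)
open import Relation.Nullary.Decidable using (map′; _×-dec_; from-yes)
open import Relation.Unary using (Pred; Decidable; _≐_)

private
  variable
    a b p q : Level
    A : Set a
    B : Set b

module _ {P : Pred B p} (P? : Decidable P) where

  length-filter-++ : ∀ (xs ys : List B) →
    length (filter P? (xs ++ ys)) ≡ length (filter P? xs) + length (filter P? ys)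
  length-filter-++ xs ys = trans (cong length (filter-++ P? xs ys)) (length-++ (filter P? xs))

  length-filter-map : ∀ {Q : Pred A q} (Q? : Decidable Q) (f : A → B) →
    P ∘ f ≐ Q → ∀ xs → length (filter P? (map f xs)) ≡ length (filter Q? xs)
  length-filter-map Q? f P∘f≐Q [] = refl
  length-filter-map Q? f P∘f≐Q@(P∘f⊆Q , Q⊆P∘f) (x ∷ xs) with P? (f x) | Q? x
  ... | yes _   | yes _  = cong suc (length-filter-map Q? f P∘f≐Q xs)
  ... | no  _   | no  _  = length-filter-map Q? f P∘f≐Q xs
  ... | yes pfx | no ¬qx = contradiction (P∘f⊆Q pfx) ¬qx
  ... | no ¬pfx | yes qx = contradiction (Q⊆P∘f qx) ¬pfx

  length-filter-map-none : ∀ (f : A → B) → (∀ x → ¬ P (f x)) →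
    ∀ xs → length (filter P? (map f xs)) ≡ 0
  length-filter-map-none f ¬P∘f xs = cong length (filter-none P? (map⁺ (universal ¬P∘f xs)))

  1≤length-filter⇒Any : ∀ xs → 1 ≤ length (filter P? xs) → Any P xs
  1≤length-filter⇒Any (x ∷ xs) h with P? x
  ... | yes px = here px
  ... | no  _  = there (1≤length-filter⇒Any xs h)

  lookup⇒1≤length-filter : ∀ xs (i : Fin (length xs)) → P (lookup xs i) →
    1 ≤ length (filter P? xs)
  lookup⇒1≤length-filter xs i pi = filter-some P? (lose (∈-lookup {xs = xs} i) pi)

  distinct-lookups⇒2≤length-filter : ∀ xs {i j : Fin (length xs)} → i ≢ j →
    P (lookup xs i) → P (lookup xs j) → 2 ≤ length (filter P? xs)
  distinct-lookups⇒2≤length-filter (x ∷ xs) {zero}  {zero}  i≢j _ _ = contradiction refl i≢j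
  distinct-lookups⇒2≤length-filter (x ∷ xs) {zero}  {suc j} _ px pj
    rewrite filter-accept P? {xs = xs} px = s≤s (lookup⇒1≤length-filter xs j pj)
  distinct-lookups⇒2≤length-filter (x ∷ xs) {suc i} {zero}  _ pi px
    rewrite filter-accept P? {xs = xs} px = s≤s (lookup⇒1≤length-filter xs i pi)
  distinct-lookups⇒2≤length-filter (x ∷ xs) {suc i} {suc j} i≢j pi pj with P? x
  ... | yes _ = m≤n⇒m≤1+n (distinct-lookups⇒2≤length-filter xs (i≢j ∘ cong suc) pi pj)
  ... | no  _ = distinct-lookups⇒2≤length-filter xs (i≢j ∘ cong suc) pi pj

_∈ₛ?_ : (x : Bool) (s : Sym) → Dec (x ∈ₛ s)
false ∈ₛ? 𝟘 = yes f∈𝟘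
true  ∈ₛ? 𝟘 = no λ ()
false ∈ₛ? 𝟙 = no λ ()
true  ∈ₛ? 𝟙 = yes t∈𝟙
_     ∈ₛ? ⋆ = yes b∈⋆

_∈F?_ : ∀ {n} (x : Point n) (a : Face n) → Dec (x ∈F a)
[]      ∈F? []      = yes []
(b ∷ x) ∈F? (s ∷ a) = map′ (uncurry _∷_) uncons (b ∈ₛ? s ×-dec x ∈F? a)
  where
  uncons : (b ∷ x) ∈F (s ∷ a) → b ∈ₛ s × x ∈F a
  uncons (b∈s ∷ x∈a) = b∈s , x∈a

coverCount : ∀ {n} → Point n → List (Face n) → ℕ
coverCount x F = length (filter (x ∈F?_) F)

-- The (n - d)-splittings of Q₂ⁿ, in a counting form that is closed under lift and glue.
record IsPartition {n} (d : ℕ) (F : List (Face n)) : Set where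
  field
    faceDim   : All (λ a → dim a ≡ d) F
    coverOnce : ∀ x → coverCount x F ≡ 1

IsPartition⇒IsSplitting : ∀ {n k} {F : List (Face n)} → IsPartition (n ∸ k) F → IsSplitting n k F
IsPartition⇒IsSplitting {F = F} part = record
  { faceDim  = λ i → All.lookup faceDim (∈-lookup {xs = F} i)
  ; disjoint = λ i j i≢j x (x∈Fᵢ , x∈Fⱼ) → 1+n≰n $
      subst (2 ≤_) (coverOnce x) (distinct-lookups⇒2≤length-filter (x ∈F?_) F i≢j x∈Fᵢ x∈Fⱼ)
  ; cover    = λ x → let x∈F = 1≤length-filter⇒Any (x ∈F?_) F (subst (1 ≤_) (sym (coverOnce x)) ≤-refl)
                     in index x∈F , lookup-index x∈F
  }
  where open IsPartition part

prefix : ∀ {n} → Sym → List (Face n) → List (Face (suc n))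
prefix s = map (s ∷_)

lift : ∀ {n} → List (Face n) → List (Face (suc n))
lift = prefix ⋆

glue : ∀ {n} → List (Face n) → List (Face n) → List (Face (suc n))
glue F G = prefix 𝟘 F ++ prefix 𝟙 G

module _ {n} {x : Point n} {b : Bool} {s : Sym} where

  coverCount-prefix : b ∈ₛ s → ∀ F → coverCount (b ∷ x) (prefix s F) ≡ coverCount x F
  coverCount-prefix b∈s = length-filter-map ((b ∷ x) ∈F?_) (x ∈F?_) (s ∷_)
    ((λ { (_ ∷ x∈a) → x∈a }) , (b∈s ∷_))

  coverCount-prefix-∉ : ¬ b ∈ₛ s → ∀ F → coverCount (b ∷ x) (prefix s F) ≡ 0
  coverCount-prefix-∉ b∉s = length-filter-map-none ((b ∷ x) ∈F?_) (s ∷_)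
    (λ { _ (b∈s ∷ _) → b∉s b∈s })

module _ {n} {v : Vec Bool n} where

  countDir-prefix : ∀ s F → countDir (isStar s ∷ v) (prefix s F) ≡ countDir v F
  countDir-prefix s = length-filter-map _ _ (s ∷_) (VecP.∷-injectiveʳ , cong (isStar s ∷_))

  countDir-prefix-≢ : ∀ {b s} → isStar s ≢ b → ∀ F → countDir (b ∷ v) (prefix s F) ≡ 0
  countDir-prefix-≢ {s = s} s≢b = length-filter-map-none _ (s ∷_) (λ _ → s≢b ∘ VecP.∷-injectiveˡ)

module _ {n} (F G : List (Face n)) where

  coverCount-glue-false : ∀ x → coverCount (false ∷ x) (glue F G) ≡ coverCount x F
  coverCount-glue-false x = begin
    coverCount (false ∷ x) (glue F G)
      ≡⟨ length-filter-++ ((false ∷ x) ∈F?_) (prefix 𝟘 F) (prefix 𝟙 G) ⟩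
    coverCount (false ∷ x) (prefix 𝟘 F) + coverCount (false ∷ x) (prefix 𝟙 G)
      ≡⟨ cong₂ _+_ (coverCount-prefix f∈𝟘 F) (coverCount-prefix-∉ (λ ()) G) ⟩
    coverCount x F + 0
      ≡⟨ +-identityʳ _ ⟩
    coverCount x F ∎
    where open ≡-Reasoning

  coverCount-glue-true : ∀ x → coverCount (true ∷ x) (glue F G) ≡ coverCount x G
  coverCount-glue-true x = trans (length-filter-++ ((true ∷ x) ∈F?_) (prefix 𝟘 F) (prefix 𝟙 G))
    (cong₂ _+_ (coverCount-prefix-∉ (λ ()) F) (coverCount-prefix t∈𝟙 G))

  countDir-glue-false : ∀ v → countDir (false ∷ v) (glue F G) ≡ countDir v F + countDir v G
  countDir-glue-false v = trans (length-filter-++ _ (prefix 𝟘 F) (prefix 𝟙 G))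
    (cong₂ _+_ (countDir-prefix 𝟘 F) (countDir-prefix 𝟙 G))

  countDir-glue-true : ∀ v → countDir (true ∷ v) (glue F G) ≡ 0
  countDir-glue-true v = trans (length-filter-++ _ (prefix 𝟘 F) (prefix 𝟙 G))
    (cong₂ _+_ (countDir-prefix-≢ (λ ()) F) (countDir-prefix-≢ (λ ()) G))

lift-partition : ∀ {n d} {F : List (Face n)} → IsPartition d F → IsPartition (suc d) (lift F)
lift-partition {F = F} part = record
  { faceDim   = map⁺ (All.map (cong suc) faceDim)
  ; coverOnce = λ { (b ∷ x) → trans (coverCount-prefix b∈⋆ F) (coverOnce x) }
  }
  where open IsPartition part

glue-partition : ∀ {n d} {F G : List (Face n)} →
  IsPartition d F → IsPartition d G → IsPartition d (glue F G)
glue-partition {F = F} {G} F-part G-part = record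
  { faceDim   = ++⁺ (map⁺ (F.faceDim)) (map⁺ (G.faceDim))
  ; coverOnce = λ where
      (false ∷ x) → trans (coverCount-glue-false F G x) (F.coverOnce x)
      (true  ∷ x) → trans (coverCount-glue-true F G x) (G.coverOnce x)
  }
  where
  module F = IsPartition F-part
  module G = IsPartition G-part

Sparse : ∀ {n} → List (Face n) → Set
Sparse F = ∀ v → countDir v F ≤ 2

lift-sparse : ∀ {n} (F : List (Face n)) → Sparse F → Sparse (lift F)
lift-sparse F F-sparse (true  ∷ v) = subst (_≤ 2) (sym (countDir-prefix ⋆ F)) (F-sparse v)
lift-sparse F F-sparse (false ∷ v) = subst (_≤ 2) (sym (countDir-prefix-≢ (λ ()) F)) z≤n

glue-sparse : ∀ {n} (F G : List (Face n)) → Sparse (F ++ G) → Sparse (glue F G)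
glue-sparse F G FG-sparse (false ∷ v) = subst (_≤ 2) eq (FG-sparse v)
  where
  eq : countDir v (F ++ G) ≡ countDir (false ∷ v) (glue F G)
  eq = trans (length-filter-++ _ F G) (sym (countDir-glue-false F G v))
glue-sparse F G FG-sparse (true ∷ v) = subst (_≤ 2) (sym (countDir-glue-true F G v)) z≤n

lift-glue-sparse : ∀ {n} (F G H : List (Face n)) → Sparse F → Sparse (G ++ H) →
  Sparse (lift F ++ glue G H)
lift-glue-sparse F G H F-sparse GH-sparse (true ∷ v) = begin
  countDir (true ∷ v) (lift F ++ glue G H)
    ≡⟨ length-filter-++ _ (lift F) (glue G H) ⟩
  countDir (true ∷ v) (lift F) + countDir (true ∷ v) (glue G H)
    ≡⟨ cong₂ _+_ (countDir-prefix ⋆ F) (countDir-glue-true G H v) ⟩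
  countDir v F + 0
    ≡⟨ +-identityʳ _ ⟩
  countDir v F
    ≤⟨ F-sparse v ⟩
  2 ∎
  where open ≤-Reasoning
lift-glue-sparse F G H F-sparse GH-sparse (false ∷ v) = begin
  countDir (false ∷ v) (lift F ++ glue G H)
    ≡⟨ length-filter-++ _ (lift F) (glue G H) ⟩
  countDir (false ∷ v) (lift F) + countDir (false ∷ v) (glue G H)
    ≡⟨ cong₂ _+_ (countDir-prefix-≢ (λ ()) F) (countDir-glue-false G H v) ⟩
  countDir v G + countDir v H
    ≡⟨ length-filter-++ _ G H ⟨
  countDir v (G ++ H)
    ≤⟨ GH-sparse v ⟩
  2 ∎
  where open ≤-Reasoning

record SparseTriple (n d : ℕ) : Set where
  field
    F G H       : List (Face n)
    F-partition : IsPartition d F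
    G-partition : IsPartition (suc d) G
    H-partition : IsPartition (suc d) H
    F-sparse    : Sparse F
    GH-sparse   : Sparse (G ++ H)

lift-triple : ∀ {n d} → SparseTriple n d → SparseTriple (suc n) (suc d)
lift-triple t = record
  { F = lift F
  ; G = lift G
  ; H = lift H
  ; F-partition = lift-partition F-partition
  ; G-partition = lift-partition G-partition
  ; H-partition = lift-partition H-partition
  ; F-sparse    = lift-sparse F F-sparse
  ; GH-sparse   = subst Sparse (map-++ (⋆ ∷_) G H) (lift-sparse (G ++ H) GH-sparse)
  }
  where open SparseTriple t

step-triple : ∀ {n d} → SparseTriple n d → SparseTriple (2 + n) (suc d)
step-triple t = record
  { F = glue (lift F) (glue G H)
  ; G = lift (lift F)
  ; H = lift (glue G H)
  ; F-partition = glue-partition (lift-partition F-partition) (glue-partition G-partition H-partition)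
  ; G-partition = lift-partition (lift-partition F-partition)
  ; H-partition = lift-partition (glue-partition G-partition H-partition)
  ; F-sparse    = glue-sparse (lift F) (glue G H) (lift-glue-sparse F G H F-sparse GH-sparse)
  ; GH-sparse   = subst Sparse (map-++ (⋆ ∷_) (lift F) (glue G H))
                    (lift-sparse (lift F ++ glue G H) (lift-glue-sparse F G H F-sparse GH-sparse))
  }
  where open SparseTriple t

all-points? : ∀ {n p} {P : Pred (Point n) p} → Decidable P → Dec (∀ x → P x)
all-points? {zero}  P? = map′ (λ P[] → λ { [] → P[] }) (_$ []) (P? [])
all-points? {suc n} P? = map′
  (λ (P₀ , P₁) → λ { (false ∷ x) → P₀ x ; (true ∷ x) → P₁ x })
  (λ P → P ∘ (false ∷_) , P ∘ (true ∷_))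
  (all-points? (P? ∘ (false ∷_)) ×-dec all-points? (P? ∘ (true ∷_)))

isPartition? : ∀ {n} d (F : List (Face n)) → Dec (IsPartition d F)
isPartition? d F = map′
  (λ (faceDim , coverOnce) → record { faceDim = faceDim ; coverOnce = coverOnce })
  (λ part → IsPartition.faceDim part , IsPartition.coverOnce part)
  (all? (λ a → dim a ≟ d) F ×-dec all-points? (λ x → coverCount x F ≟ 1))

sparse? : ∀ {n} (F : List (Face n)) → Dec (Sparse F)
sparse? F = all-points? (λ v → countDir v F ≤? 2)

base-triple₁ : SparseTriple 1 0
base-triple₁ = record
  { F = F ; G = G ; H = G
  ; F-partition = from-yes (isPartition? 0 F)
  ; G-partition = from-yes (isPartition? 1 G)
  ; H-partition = from-yes (isPartition? 1 G)
  ; F-sparse    = from-yes (sparse? F)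
  ; GH-sparse   = from-yes (sparse? (G ++ G))
  }
  where
  F G : List (Face 1)
  F = (𝟘 ∷ []) ∷ (𝟙 ∷ []) ∷ []
  G = (⋆ ∷ []) ∷ []

base-triple₄ : SparseTriple 4 1
base-triple₄ = record
  { F = F ; G = G ; H = H
  ; F-partition = from-yes (isPartition? 1 F)
  ; G-partition = from-yes (isPartition? 2 G)
  ; H-partition = from-yes (isPartition? 2 H)
  ; F-sparse    = from-yes (sparse? F)
  ; GH-sparse   = from-yes (sparse? (G ++ H))
  }
  where
  F G H : List (Face 4)
  F = (⋆ ∷ 𝟘 ∷ 𝟘 ∷ 𝟘 ∷ []) ∷ (⋆ ∷ 𝟘 ∷ 𝟘 ∷ 𝟙 ∷ []) ∷ (𝟘 ∷ ⋆ ∷ 𝟙 ∷ 𝟘 ∷ []) ∷ (𝟘 ∷ ⋆ ∷ 𝟙 ∷ 𝟙 ∷ []) ∷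
      (𝟘 ∷ 𝟙 ∷ 𝟘 ∷ ⋆ ∷ []) ∷ (𝟙 ∷ 𝟘 ∷ 𝟙 ∷ ⋆ ∷ []) ∷ (𝟙 ∷ 𝟙 ∷ ⋆ ∷ 𝟘 ∷ []) ∷ (𝟙 ∷ 𝟙 ∷ ⋆ ∷ 𝟙 ∷ []) ∷ []
  G = (𝟘 ∷ 𝟘 ∷ ⋆ ∷ ⋆ ∷ []) ∷ (𝟘 ∷ 𝟙 ∷ ⋆ ∷ ⋆ ∷ []) ∷ (𝟙 ∷ ⋆ ∷ 𝟘 ∷ ⋆ ∷ []) ∷ (𝟙 ∷ ⋆ ∷ 𝟙 ∷ ⋆ ∷ []) ∷ []
  H = (⋆ ∷ ⋆ ∷ 𝟘 ∷ 𝟘 ∷ []) ∷ (⋆ ∷ ⋆ ∷ 𝟘 ∷ 𝟙 ∷ []) ∷ (⋆ ∷ 𝟘 ∷ 𝟙 ∷ ⋆ ∷ []) ∷ (⋆ ∷ 𝟙 ∷ 𝟙 ∷ ⋆ ∷ []) ∷ []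

sparse-triple : ∀ d k → k ≤ d + 2 → SparseTriple (suc k + suc d) (suc d)
sparse-triple zero    zero                _ = lift-triple base-triple₁
sparse-triple zero    (suc zero)          _ = step-triple base-triple₁
sparse-triple zero    (suc (suc zero))    _ = base-triple₄
sparse-triple zero    (suc (suc (suc k))) (s≤s (s≤s ()))
sparse-triple (suc d) zero                _ = lift-triple (sparse-triple d zero z≤n)
sparse-triple (suc d) (suc k)             k≤d+2 =
  subst (λ m → SparseTriple (2 + m) (2 + d)) (sym (+-suc k (suc d)))
    (step-triple (sparse-triple d k (≤-pred k≤d+2)))

m<n⇒∃[o]m+suc[o]≡n : ∀ {m n} → m < n → ∃ λ o → m + suc o ≡ n
m<n⇒∃[o]m+suc[o]≡n {m} m<n with o , m+1+o≡n ← m≤n⇒∃[o]m+o≡n m<n = o , trans (+-suc m o) m+1+o≡n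

codim≤dim+2 : ∀ k d → 2 * k ≤ k + d + 2 → k ≤ d + 2
codim≤dim+2 k d 2k≤n+2 = +-cancelˡ-≤ k k (d + 2) $ begin
  k + k       ≡⟨ cong (k +_) (+-identityʳ k) ⟨
  2 * k       ≤⟨ 2k≤n+2 ⟩
  k + d + 2   ≡⟨ +-assoc k d 2 ⟩
  k + (d + 2) ∎
  where open ≤-Reasoning

proposition6 : (n k : ℕ) → 0 < k → k < n → 2 * k ≤ n + 2 →
    Σ (List (Face n)) λ F → IsSplitting n k F × ((d : Vec Bool n) → countDir d F ≤ 2)
proposition6 n zero    ()
proposition6 n (suc k) _ k<n 2k≤n+2 with d , refl ← m<n⇒∃[o]m+suc[o]≡n k<n =
  F , IsPartition⇒IsSplitting F-partition′ , F-sparse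
  where
  open SparseTriple (sparse-triple d k (≤-pred (codim≤dim+2 (suc k) (suc d) 2k≤n+2)))
  F-partition′ : IsPartition (suc k + suc d ∸ suc k) F
  F-partition′ = subst (λ e → IsPartition e F) (sym (m+n∸m≡n (suc k) (suc d))) F-partition
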